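{- Let $N$ be a positive integer. If $\alpha,\beta\in\mathrm{OC}_{\le N}$ satisfy $\ell(\alpha)<\ell(\beta)$, then $S_N(\alpha)<S_N(\beta)$.
   Context: An odd composition is a finite sequence of odd positive integers; $\mathrm{OC}_{\le N}$ is the set of odd compositions of integers in $\{0,\ldots,N\}$ (including the empty one); $\ell(\alpha)$ is the number of parts. $\sigma_N$ is the permutation of $\{1,\ldots,N\}$ with $\sigma_N(i)=i/2$ for $i$ even and $\sigma_N(i)=N+(1-i)/2$ for $i$ odd, and $S_N(\alpha)=\sum_{i=1}^{\ell(\alpha)}\sigma_N(\alpha_1+\cdots+\alpha_i)$. -}

module Defs where

open import Data.Nat using (ℕ; zero; suc; _+_; _∸_; _≤_; _<_; ⌊_/2⌋)
open import Data.Nat.Divisibility using (_∣_; _∣?_)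
open import Relation.Nullary using (¬_)
open import Data.List using (List; []; _∷_; length)
open import Data.Nat.ListAction using (sum)
open import Data.List.Relation.Unary.All using (All)
open import Data.Product using (_×_)
open import Relation.Nullary.Decidable using (yes; no)

-- An odd composition: a finite list of odd positive integers
-- (odd naturals are automatically positive).
Odd : ℕ → Set
Odd n = ¬ (2 ∣ n)

IsOddComposition : List ℕ → Set
IsOddComposition α = All Odd α

OC≤ : ℕ → List ℕ → Set
OC≤ N α = IsOddComposition α × sum α ≤ N

-- σ_N(i) = i/2 for i even, N + (1 - i)/2 = N - (i-1)/2 for i odd
-- (only used for 1 ≤ i ≤ N, where no truncation occurs).
σ : ℕ → ℕ → ℕ
σ N i with 2 ∣? i
... | yes _ = ⌊ i /2⌋
... | no  _ = N ∸ ⌊ i /2⌋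

-- S_N(α) = Σ_{i=1}^{ℓ(α)} σ_N(α₁ + ⋯ + αᵢ), computed with a running offset.
S-from : ℕ → ℕ → List ℕ → ℕ
S-from N acc [] = 0
S-from N acc (a ∷ α) = σ N (acc + a) + S-from N (acc + a) α

S : ℕ → List ℕ → ℕ
S N α = S-from N 0 α

ℓ : List ℕ → ℕ
ℓ = length

{-# OPTIONS --safe #-}
-- The parts being odd, the partial sums of α alternate in parity, odd first. Writing the running sum
-- as 2h or 2m+1, σ_N contributes m at 2m and N ∸ m at 2m+1, and induction along α (with h or m as
-- parameter) gives ℓ(α)(N+1) ≤ 2 S_N(α) ≤ (ℓ(α)+1)N. The bounds carried at an odd running sum 2m+1
-- are the even ones with the contribution N ∸ m of that sum taken out. The intervals
-- [ℓ(N+1), (ℓ+1)N] increase strictly with ℓ.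
module Submission where

open import Defs
open import Data.Nat using (ℕ; _<_; NonZero)
open import Data.List using (List)

open import Data.Nat using (zero; suc; _+_; _*_; _∸_; _≤_; ⌊_/2⌋; ⌈_/2⌉; z≤n; s≤s)
open import Data.Nat.Properties
open import Data.Nat.Divisibility using (_∣?_; divides; _∣0; n∣n; ∣m∣n⇒∣m+n; m∣m*n)
open import Data.Nat.ListAction using (sum)
open import Data.Nat.Tactic.RingSolver using (solve-∀)
open import Data.List using ([]; _∷_; length)
open import Data.List.Relation.Unary.All using (All; []; _∷_)
open import Data.Product using (∃-syntax; _,_)
open import Function using (_∘_)
open import Relation.Nullary using (yes; no; contradiction)
open import Relation.Binary.PropositionalEquality using (_≡_; refl; sym; trans; cong; subst; subst₂)

open ≤-Reasoning

Odd⇒≡1+2* : ∀ {a} → Odd a → ∃[ c ] a ≡ suc (2 * c)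
Odd⇒≡1+2* {zero}        odd = contradiction (2 ∣0) odd
Odd⇒≡1+2* {suc zero}    _   = 0 , refl
Odd⇒≡1+2* {suc (suc a)} odd with Odd⇒≡1+2* (odd ∘ ∣m∣n⇒∣m+n n∣n)
... | c , refl = suc c , cong suc (sym (*-suc 2 c))

2*m≡m+m : ∀ m → 2 * m ≡ m + m
2*m≡m+m m = cong (m +_) (+-identityʳ m)

σ-2* : ∀ N m → σ N (2 * m) ≡ m
σ-2* N m with 2 ∣? 2 * m
... | yes _   = trans (cong ⌊_/2⌋ (2*m≡m+m m)) (sym (n≡⌊n+n/2⌋ m))
... | no 2∤2m = contradiction (m∣m*n m) 2∤2m

σ-1+2* : ∀ N m → σ N (suc (2 * m)) ≡ N ∸ m
σ-1+2* N m with 2 ∣? suc (2 * m)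
... | yes (divides q eq) = contradiction (trans (*-comm 2 q) (sym eq)) (even≢odd q m)
... | no _               = cong (N ∸_) (trans (cong ⌈_/2⌉ (2*m≡m+m m)) (sym (n≡⌈n+n/2⌉ m)))

S-from-∷ : ∀ N acc a α {p v} → acc + a ≡ p → σ N p ≡ v → S-from N acc (a ∷ α) ≡ v + S-from N p α
S-from-∷ N acc a α refl refl = refl

2h+[1+2c]≡1+2[h+c] : ∀ h c → 2 * h + suc (2 * c) ≡ suc (2 * (h + c))
2h+[1+2c]≡1+2[h+c] = solve-∀

[1+2m]+[1+2d]≡2[1+m+d] : ∀ m d → suc (2 * m) + suc (2 * d) ≡ 2 * suc (m + d)
[1+2m]+[1+2d]≡2[1+m+d] = solve-∀

S-from-2*-∷ : ∀ N h c α →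
  S-from N (2 * h) (suc (2 * c) ∷ α) ≡ N ∸ (h + c) + S-from N (suc (2 * (h + c))) α
S-from-2*-∷ N h c α = S-from-∷ N (2 * h) (suc (2 * c)) α (2h+[1+2c]≡1+2[h+c] h c) (σ-1+2* N (h + c))

S-from-1+2*-∷ : ∀ N m d α →
  S-from N (suc (2 * m)) (suc (2 * d) ∷ α) ≡ suc (m + d) + S-from N (2 * suc (m + d)) α
S-from-1+2*-∷ N m d α =
  S-from-∷ N (suc (2 * m)) (suc (2 * d)) α ([1+2m]+[1+2d]≡2[1+m+d] m d) (σ-2* N (suc (m + d)))

+-≤-shift : ∀ acc a s {p N} → acc + a ≡ p → acc + (a + s) ≤ N → p + s ≤ N
+-≤-shift acc a s {N = N} eq = subst (_≤ N) (trans (sym (+-assoc acc a s)) (cong (_+ s) eq))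

m≤1+2*m+n : ∀ m n → m ≤ suc (2 * m) + n
m≤1+2*m+n m n = m≤n⇒m≤1+n (≤-trans (m≤m+n m (m + 0)) (m≤m+n (2 * m) n))

S-from-2*-lower-step : ∀ {N} n m k Y → n + m ≡ N →
  suc (2 * m) + k * suc N ≤ 2 * Y + N → suc k * suc N ≤ 2 * (n + Y)
S-from-2*-lower-step n m k Y refl ih = +-cancelʳ-≤ (n + m) _ _ (begin
  suc k * suc (n + m) + (n + m)            ≡⟨ regroup n m k ⟩
  2 * n + (suc (2 * m) + k * suc (n + m))  ≤⟨ +-monoʳ-≤ (2 * n) ih ⟩
  2 * n + (2 * Y + (n + m))                ≡⟨ collect n m Y ⟩
  2 * (n + Y) + (n + m)                    ∎)
  where
  regroup : ∀ n m k → suc k * suc (n + m) + (n + m) ≡ 2 * n + (suc (2 * m) + k * suc (n + m))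
  regroup = solve-∀
  collect : ∀ n m Y → 2 * n + (2 * Y + (n + m)) ≡ 2 * (n + Y) + (n + m)
  collect = solve-∀

S-from-1+2*-lower-step : ∀ {N} m d k X →
  k * suc N ≤ 2 * X → suc (2 * m) + suc k * suc N ≤ 2 * (suc (m + d) + X) + N
S-from-1+2*-lower-step {N} m d k X ih = begin
  suc (2 * m) + suc k * suc N      ≡⟨ regroup N m k ⟩
  (2 * suc m + N) + k * suc N      ≤⟨ +-monoʳ-≤ (2 * suc m + N) (≤-trans ih (m≤n+m (2 * X) (2 * d))) ⟩
  (2 * suc m + N) + (2 * d + 2 * X) ≡⟨ collect N m d X ⟩
  2 * (suc (m + d) + X) + N        ∎
  where
  regroup : ∀ N m k → suc (2 * m) + suc k * suc N ≡ (2 * suc m + N) + k * suc N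
  regroup = solve-∀
  collect : ∀ N m d X → (2 * suc m + N) + (2 * d + 2 * X) ≡ 2 * (suc (m + d) + X) + N
  collect = solve-∀

S-from-2*-upper-step : ∀ {N} n m h k Y → n + m ≡ N → h ≤ m →
  2 * Y ≤ k * N → 2 * (n + Y) + 2 * h ≤ suc (suc k) * N
S-from-2*-upper-step n m h k Y refl h≤m ih = begin
  2 * (n + Y) + 2 * h          ≡⟨ regroup n Y h ⟩
  2 * (n + h) + 2 * Y          ≤⟨ +-mono-≤ (*-monoʳ-≤ 2 (+-monoʳ-≤ n h≤m)) ih ⟩
  2 * (n + m) + k * (n + m)    ≡⟨ collect (n + m) k ⟩
  suc (suc k) * (n + m)        ∎
  where
  regroup : ∀ n Y h → 2 * (n + Y) + 2 * h ≡ 2 * (n + h) + 2 * Y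
  regroup = solve-∀
  collect : ∀ N k → 2 * N + k * N ≡ suc (suc k) * N
  collect = solve-∀

mutual
  S-from-2*-lower : ∀ N h α → All Odd α → 2 * h + sum α ≤ N →
    length α * suc N ≤ 2 * S-from N (2 * h) α
  S-from-2*-lower N h []      []            _ = z≤n
  S-from-2*-lower N h (a ∷ α) (odd ∷ odds) H with Odd⇒≡1+2* odd
  ... | c , refl rewrite S-from-2*-∷ N h c α =
    S-from-2*-lower-step (N ∸ m) m (length α) (S-from N (suc (2 * m)) α)
      (m∸n+n≡m (≤-trans (m≤1+2*m+n m (sum α)) H′)) (S-from-1+2*-lower N m α odds H′)
    where
    m : ℕ
    m = h + c
    H′ : suc (2 * m) + sum α ≤ N
    H′ = +-≤-shift (2 * h) (suc (2 * c)) (sum α) (2h+[1+2c]≡1+2[h+c] h c) H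

  S-from-1+2*-lower : ∀ N m α → All Odd α → suc (2 * m) + sum α ≤ N →
    suc (2 * m) + length α * suc N ≤ 2 * S-from N (suc (2 * m)) α + N
  S-from-1+2*-lower N m []      []            H = H
  S-from-1+2*-lower N m (b ∷ α) (odd ∷ odds) H with Odd⇒≡1+2* odd
  ... | d , refl rewrite S-from-1+2*-∷ N m d α =
    S-from-1+2*-lower-step m d (length α) (S-from N (2 * suc (m + d)) α)
      (S-from-2*-lower N (suc (m + d)) α odds
        (+-≤-shift (suc (2 * m)) (suc (2 * d)) (sum α) ([1+2m]+[1+2d]≡2[1+m+d] m d) H))

mutual
  S-from-2*-upper : ∀ N h α → All Odd α → 2 * h + sum α ≤ N →
    2 * S-from N (2 * h) α + 2 * h ≤ suc (length α) * N
  S-from-2*-upper N h []      []            H = subst₂ _≤_ (+-identityʳ (2 * h)) (sym (+-identityʳ N)) H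
  S-from-2*-upper N h (a ∷ α) (odd ∷ odds) H with Odd⇒≡1+2* odd
  ... | c , refl rewrite S-from-2*-∷ N h c α =
    S-from-2*-upper-step (N ∸ m) m h (length α) (S-from N (suc (2 * m)) α)
      (m∸n+n≡m (≤-trans (m≤1+2*m+n m (sum α)) H′)) (m≤m+n h c) (S-from-1+2*-upper N m α odds H′)
    where
    m : ℕ
    m = h + c
    H′ : suc (2 * m) + sum α ≤ N
    H′ = +-≤-shift (2 * h) (suc (2 * c)) (sum α) (2h+[1+2c]≡1+2[h+c] h c) H

  S-from-1+2*-upper : ∀ N m α → All Odd α → suc (2 * m) + sum α ≤ N →
    2 * S-from N (suc (2 * m)) α ≤ length α * N
  S-from-1+2*-upper N m []      []            _ = z≤n
  S-from-1+2*-upper N m (b ∷ α) (odd ∷ odds) H with Odd⇒≡1+2* odd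
  ... | d , refl rewrite S-from-1+2*-∷ N m d α =
    subst (_≤ suc (length α) * N) (trans (+-comm (2 * X) (2 * m′)) (sym (*-distribˡ-+ 2 m′ X)))
      (S-from-2*-upper N m′ α odds
        (+-≤-shift (suc (2 * m)) (suc (2 * d)) (sum α) ([1+2m]+[1+2d]≡2[1+m+d] m d) H))
    where
    m′ : ℕ
    m′ = suc (m + d)
    X : ℕ
    X = S-from N (2 * m′) α

proposition3p3 : (N : ℕ) → .{{_ : NonZero N}} → (α β : List ℕ) → OC≤ N α → OC≤ N β → ℓ α < ℓ β → S N α < S N β
proposition3p3 N α β (oddα , sumα≤N) (oddβ , sumβ≤N) ℓα<ℓβ = *-cancelˡ-< 2 (S N α) (S N β) (begin-strict
  2 * S N α             ≡⟨ +-identityʳ (2 * S N α) ⟨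
  2 * S N α + 0         ≤⟨ S-from-2*-upper N 0 α oddα sumα≤N ⟩
  suc (ℓ α) * N         ≤⟨ *-monoˡ-≤ N ℓα<ℓβ ⟩
  ℓ β * N               <⟨ m<n+m (ℓ β * N) (≤-trans (s≤s z≤n) ℓα<ℓβ) ⟩
  ℓ β + ℓ β * N         ≡⟨ *-suc (ℓ β) N ⟨
  ℓ β * suc N           ≤⟨ S-from-2*-lower N 0 β oddβ sumβ≤N ⟩
  2 * S N β             ∎)
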